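{- Let $T=(V,E)$ be a tree with $n=|V|\ge 2$ vertices. Then $\ell(T)=2n-2$.
   Context: A word $w$ over the alphabet $V$ word-represents a graph $G=(V,E)$ if $w$ contains every letter of $V$ at least once and for all distinct $x,y\in V$, $xy\in E$ if and only if $x$ and $y$ alternate in $w$ (the subword of $w$ consisting only of occurrences of $x$ and $y$ has no two equal consecutive letters). For a graph admitting such a word, $\ell(G)$ is the minimum length of a word that word-represents $G$. -}

module Defs where

open import Data.Nat using (ℕ; zero; suc; _+_; _≤_; _*_; _∸_)
open import Data.Fin using (Fin; _≟_)
open import Data.Bool using (Bool; true; false; T)
open import Data.List using (List; []; _∷_; length; filter)
open import Data.List.Membership.Propositional using (_∈_)
open import Data.List.Relation.Unary.Unique.Propositional using (Unique)
open import Data.Product using (Σ; _×_; _,_; ∃)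
open import Data.Sum using (_⊎_)
open import Relation.Binary.PropositionalEquality using (_≡_)
open import Relation.Nullary using (¬_; Dec)
open import Relation.Nullary.Decidable using (_⊎-dec_)

record Graph (n : ℕ) : Set where
  field
    adj   : Fin n → Fin n → Bool
    sym   : ∀ x y → adj x y ≡ adj y x
    irrefl : ∀ x → adj x x ≡ false
open Graph public

Edge : ∀ {n} → Graph n → Fin n → Fin n → Set
Edge G x y = T (adj G x y)

data IsWalk {n} (G : Graph n) : List (Fin n) → Set where
  single : ∀ v → IsWalk G (v ∷ [])
  step   : ∀ u v vs → Edge G u v → IsWalk G (v ∷ vs) → IsWalk G (u ∷ v ∷ vs)

head? : ∀ {n} → List (Fin n) → Fin n → Set
head? [] _ = Data.Empty.⊥ where import Data.Empty
head? (x ∷ _) v = x ≡ v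

last? : ∀ {n} → List (Fin n) → Fin n → Set
last? [] _ = Data.Empty.⊥ where import Data.Empty
last? (x ∷ []) v = x ≡ v
last? (_ ∷ y ∷ ys) v = last? (y ∷ ys) v

Connected : ∀ {n} → Graph n → Set
Connected {n} G = ∀ (x y : Fin n) →
  Σ (List (Fin n)) λ p → IsWalk G p × head? p x × last? p y

IsCycle : ∀ {n} → Graph n → List (Fin n) → Set
IsCycle G p = 3 ≤ length p × Unique p × IsWalk G p ×
  Σ _ λ u → Σ _ λ v → head? p u × last? p v × Edge G v u

Acyclic : ∀ {n} → Graph n → Set
Acyclic {n} G = ∀ (p : List (Fin n)) → ¬ IsCycle G p

IsTree : ∀ {n} → Graph n → Set
IsTree G = Connected G × Acyclic G

restrict : ∀ {n} → Fin n → Fin n → List (Fin n) → List (Fin n)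
restrict x y = filter (λ z → (z ≟ x) ⊎-dec (z ≟ y))

NoRepeat : ∀ {n} → List (Fin n) → Set
NoRepeat [] = Data.Unit.⊤ where import Data.Unit
NoRepeat (_ ∷ []) = Data.Unit.⊤ where import Data.Unit
NoRepeat (a ∷ b ∷ rest) = ¬ (a ≡ b) × NoRepeat (b ∷ rest)

Alternate : ∀ {n} → List (Fin n) → Fin n → Fin n → Set
Alternate w x y = NoRepeat (restrict x y w)

WordRepresents : ∀ {n} → List (Fin n) → Graph n → Set
WordRepresents {n} w G =
  (∀ (v : Fin n) → v ∈ w) ×
  (∀ (x y : Fin n) → ¬ (x ≡ y) → (Edge G x y → Alternate w x y) × (Alternate w x y → Edge G x y))

MinRepLength : ∀ {n} → Graph n → ℕ → Set
MinRepLength {n} G m =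
  (Σ (List (Fin n)) λ w → WordRepresents w G × length w ≡ m) ×
  (∀ (w : List (Fin n)) → WordRepresents w G → m ≤ length w)

module Submission where

-- Lower bound (for every triangle-free graph, so in particular for trees).  Two letters that
-- occur exactly once in a word always alternate, so in a representing word the letters
-- occurring once form a clique, which has at most two vertices.  Every other vertex occurs at
-- least twice, and all n vertices occur, so the length is at least 2n − 2 (double counting
-- occurrences letter by letter).
--
-- Upper bound, by induction on the number of vertices of a connected induced subgraph of the
-- tree.  The end of a maximal path is a leaf e with a unique neighbour u; removing e keeps the
-- subgraph connected.  Starting from the word  ab  for a single edge, take a word for the
-- subgraph without e in which every letter occurs at most twice, and replace one occurrence of u
-- by  e u e : then e alternates with u and with nobody else, all other pairs are unaffected, and
-- the length grows by 2.

open import Defs hiding (sym)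
open import Data.Nat using (ℕ; zero; suc; _+_; _*_; _∸_; _≤_; z≤n; s≤s)
open import Data.Nat.Properties using (suc-injective; *-suc; m+[n∸m]≡n; <-irrefl; m≤m+n; +-identityʳ; ∸-monoˡ-≤; m+n∸n≡m; ≤-pred; +-monoʳ-≤; +-mono-≤; +-assoc; ≤∧≢⇒<; module ≤-Reasoning; ≤-refl; ≤-reflexive; ≤-trans; n≤1+n; +-suc)
open import Data.Fin using (Fin; _≟_)
open import Data.Nat using () renaming (_≟_ to _≟ℕ_)
open import Data.List using (List; []; _∷_; _++_; length; filter; replicate; map; allFin)
open import Data.Nat.ListAction using (sum)
open import Data.List.Properties using (length-filter; ++-assoc; filter-all; length-tabulate; filter-accept; filter-reject; filter-++; filter-none; filter-some; filter-≐; length-++; length-++-sucʳ)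
open import Data.List.Membership.Propositional using (_∈_; _∉_; lose; find)
open import Data.List.Relation.Binary.Subset.Propositional using (_⊆_)
open import Data.List.Membership.Propositional.Properties using (∈-∃++; ∈-allFin; ∈-filter⁺; ∈-filter⁻; ∈-++⁺ˡ; ∈-++⁺ʳ; ∈-++⁻)
open import Data.List.Relation.Unary.Any using (here; there; any?)
open import Data.List.Relation.Unary.All.Properties using (¬Any⇒All¬; All¬⇒¬Any; ++⁻ˡ)
open import Data.List.Relation.Unary.Unique.Propositional using (Unique)
open import Data.List.Relation.Unary.Unique.Propositional.Properties using (filter⁺; allFin⁺)
open import Data.List.Relation.Unary.AllPairs using ([]; _∷_)
open import Data.List.Relation.Unary.All as All using ([]; _∷_)
open import Data.Product using (Σ; _×_; _,_; proj₁; proj₂)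
open import Data.Sum using (_⊎_; inj₁; inj₂; [_,_]; swap)
open import Data.Unit using (tt)
open import Data.Bool using (true; false; T)
open import Data.Bool.Properties using (T?)
open import Data.Empty using (⊥; ⊥-elim)
open import Function using (_∘_; id)
open import Relation.Binary.PropositionalEquality using (_≡_; _≢_; refl; sym; trans; cong; cong₂; subst; module ≡-Reasoning)
open import Relation.Nullary using (Dec; ¬_; yes; no; does; contradiction)
open import Relation.Nullary.Decidable using (_⊎-dec_; _×-dec_; ¬?; decidable-stable)
open import Relation.Unary using (Pred; Decidable)

module Words {n : ℕ} where

  private
    V : Set
    V = Fin n

  occ : V → List V → ℕ
  occ v w = length (filter (v ≟_) w)

  occ-here : ∀ v w → occ v (v ∷ w) ≡ suc (occ v w)
  occ-here v w = cong length (filter-accept (v ≟_) refl)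

  occ-there : ∀ {v z} w → v ≢ z → occ v (z ∷ w) ≡ occ v w
  occ-there w v≢z = cong length (filter-reject (_ ≟_) v≢z)

  occ-tail : ∀ v z w → occ v w ≤ occ v (z ∷ w)
  occ-tail v z w = by-cases (v ≟ z)
    where
      by-cases : Dec (v ≡ z) → occ v w ≤ occ v (z ∷ w)
      by-cases (yes refl) = subst (occ v w ≤_) (sym (occ-here v w)) (n≤1+n _)
      by-cases (no v≢z)   = ≤-reflexive (sym (occ-there w v≢z))

  occ-∈ : ∀ {v w} → v ∈ w → 1 ≤ occ v w
  occ-∈ {v} = filter-some (v ≟_)

  occ-∉ : ∀ {v} w → v ∉ w → occ v w ≡ 0
  occ-∉ {v} w v∉w = cong length (filter-none (v ≟_) (¬Any⇒All¬ w v∉w))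

  occ-++ : ∀ v xs ys → occ v (xs ++ ys) ≡ occ v xs + occ v ys
  occ-++ v xs ys = trans (cong length (filter-++ (v ≟_) xs ys)) (length-++ (filter (v ≟_) xs))

  pair? : (x y : V) → Decidable (λ z → z ≡ x ⊎ z ≡ y)
  pair? x y z = (z ≟ x) ⊎-dec (z ≟ y)

  restrict-keep : ∀ {x y z} w → z ≡ x ⊎ z ≡ y → restrict x y (z ∷ w) ≡ z ∷ restrict x y w
  restrict-keep {x} {y} w = filter-accept (pair? x y) {xs = w}

  restrict-skip : ∀ {x y z} w → z ≢ x → z ≢ y → restrict x y (z ∷ w) ≡ restrict x y w
  restrict-skip {x} {y} w z≢x z≢y =
    filter-reject (pair? x y) {xs = w} λ { (inj₁ z≡x) → z≢x z≡x ; (inj₂ z≡y) → z≢y z≡y }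

  alternate-sym : ∀ w {x y} → Alternate w x y → Alternate w y x
  alternate-sym w {x} {y} =
    subst NoRepeat (filter-≐ (pair? x y) (pair? y x) (swap , swap) w)

  unique⇒noRepeat : (l : List V) → Unique l → NoRepeat l
  unique⇒noRepeat []            _                 = tt
  unique⇒noRepeat (_ ∷ [])      _                 = tt
  unique⇒noRepeat (a ∷ b ∷ l)   ((a≢b ∷ _) ∷ u)   = a≢b , unique⇒noRepeat (b ∷ l) u

  repeat-breaks : ∀ {e : V} xs ys → ¬ NoRepeat (xs ++ e ∷ e ∷ ys)
  repeat-breaks []           ys (e≢e , _) = e≢e refl
  repeat-breaks (_ ∷ [])     ys (_ , nr)  = repeat-breaks [] ys nr
  repeat-breaks (_ ∷ b ∷ xs) ys (_ , nr)  = repeat-breaks (b ∷ xs) ys nr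

  restrict-without : ∀ {e u} w → e ∉ w → restrict e u w ≡ replicate (occ u w) u
  restrict-without []      _   = refl
  restrict-without {e} {u} (z ∷ w) e∉ = by-cases (u ≟ z)
    where
      e∉w : e ∉ w
      e∉w = e∉ ∘ there
      by-cases : Dec (u ≡ z) → restrict e u (z ∷ w) ≡ replicate (occ u (z ∷ w)) u
      by-cases (yes refl) rewrite occ-here u w =
        trans (restrict-keep w (inj₂ refl)) (cong (u ∷_) (restrict-without w e∉w))
      by-cases (no u≢z) rewrite occ-there w u≢z =
        trans (restrict-skip w (λ z≡e → e∉ (here (sym z≡e))) (λ z≡u → u≢z (sym z≡u)))
              (restrict-without w e∉w)

  wrap : V → List V → V → List V → List V
  wrap e pre u post = pre ++ e ∷ u ∷ e ∷ post

  length-wrap : ∀ e pre u post → length (wrap e pre u post) ≡ 2 + length (pre ++ u ∷ post)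
  length-wrap e pre u post = begin
    length (pre ++ e ∷ u ∷ e ∷ post)  ≡⟨ length-++-sucʳ pre e _ ⟩
    1 + length (pre ++ u ∷ e ∷ post)  ≡⟨ cong suc (length-++-sucʳ pre u _) ⟩
    2 + length (pre ++ e ∷ post)      ≡⟨ cong (2 +_) (length-++-sucʳ pre e post) ⟩
    3 + length (pre ++ post)          ≡⟨ cong (2 +_) (sym (length-++-sucʳ pre u post)) ⟩
    2 + length (pre ++ u ∷ post)      ∎
    where open ≡-Reasoning

  wrap-∈-new : ∀ e pre u post → e ∈ wrap e pre u post
  wrap-∈-new e pre u post = ∈-++⁺ʳ pre (here refl)

  wrap-∈-old : ∀ {v} e pre u post → v ∈ pre ++ u ∷ post → v ∈ wrap e pre u post
  wrap-∈-old e pre u post v∈ with ∈-++⁻ pre v∈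
  ... | inj₁ v∈pre         = ∈-++⁺ˡ v∈pre
  ... | inj₂ (here v≡u)    = ∈-++⁺ʳ pre (there (here v≡u))
  ... | inj₂ (there v∈post) = ∈-++⁺ʳ pre (there (there (there v∈post)))

  wrap-∈⁻ : ∀ {v} e pre u post → v ∈ wrap e pre u post → v ≡ e ⊎ v ∈ pre ++ u ∷ post
  wrap-∈⁻ e pre u post v∈ with ∈-++⁻ pre v∈
  ... | inj₁ v∈pre                        = inj₂ (∈-++⁺ˡ v∈pre)
  ... | inj₂ (here v≡e)                   = inj₁ v≡e
  ... | inj₂ (there (here v≡u))           = inj₂ (∈-++⁺ʳ pre (here v≡u))
  ... | inj₂ (there (there (here v≡e)))   = inj₁ v≡e
  ... | inj₂ (there (there (there v∈post))) = inj₂ (∈-++⁺ʳ pre (there v∈post))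

  module _ {p} {P : Pred V p} (P? : Decidable P) {e u : V} (pre post : List V) where

    private
      filter-∷-cong : ∀ z {xs ys} → filter P? xs ≡ filter P? ys → filter P? (z ∷ xs) ≡ filter P? (z ∷ ys)
      filter-∷-cong z eq with does (P? z)
      ... | true  = cong (z ∷_) eq
      ... | false = eq

      filter-around : ∀ {m m′} → filter P? m ≡ m′ → filter P? (pre ++ m) ≡ filter P? pre ++ m′
      filter-around {m} eq = trans (filter-++ P? pre m) (cong (filter P? pre ++_) eq)

    filter-wrap-hidden : ¬ P e → filter P? (wrap e pre u post) ≡ filter P? (pre ++ u ∷ post)
    filter-wrap-hidden ¬Pe =
      trans (filter-around (trans (filter-reject P? ¬Pe) (filter-∷-cong u (filter-reject P? ¬Pe))))
            (sym (filter-++ P? pre (u ∷ post)))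

    filter-wrap-ee : P e → ¬ P u → filter P? (wrap e pre u post) ≡ filter P? pre ++ e ∷ e ∷ filter P? post
    filter-wrap-ee Pe ¬Pu =
      filter-around (trans (filter-accept P? Pe) (cong (e ∷_) (trans (filter-reject P? ¬Pu) (filter-accept P? Pe))))

    filter-wrap-eue : P e → P u → filter P? (wrap e pre u post) ≡ filter P? pre ++ e ∷ u ∷ e ∷ filter P? post
    filter-wrap-eue Pe Pu =
      filter-around (trans (filter-accept P? Pe) (cong (e ∷_) (trans (filter-accept P? Pu) (cong (u ∷_) (filter-accept P? Pe)))))

  module _ {e u : V} (pre post : List V) where

    occ-wrap-old : ∀ {v} → v ≢ e → occ v (wrap e pre u post) ≡ occ v (pre ++ u ∷ post)
    occ-wrap-old {v} v≢e = cong length (filter-wrap-hidden (v ≟_) pre post v≢e)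

    occ-wrap-new : e ∉ pre ++ u ∷ post → e ≢ u → occ e (wrap e pre u post) ≡ 2
    occ-wrap-new e∉ e≢u = begin
      occ e (wrap e pre u post)                              ≡⟨ cong length (filter-wrap-ee (e ≟_) pre post refl e≢u) ⟩
      length (filter (e ≟_) pre ++ e ∷ e ∷ filter (e ≟_) post) ≡⟨ length-++ (filter (e ≟_) pre) ⟩
      occ e pre + (2 + occ e post)                            ≡⟨ cong₂ (λ a b → a + (2 + b)) (occ-∉ pre (e∉ ∘ ∈-++⁺ˡ))
                                                                                              (occ-∉ post (e∉ ∘ ∈-++⁺ʳ pre ∘ there)) ⟩
      2                                                       ∎
      where open ≡-Reasoning

    restrict-wrap-old : ∀ {x y} → x ≢ e → y ≢ e → restrict x y (wrap e pre u post) ≡ restrict x y (pre ++ u ∷ post)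
    restrict-wrap-old {x} {y} x≢e y≢e =
      filter-wrap-hidden (pair? x y) pre post λ { (inj₁ e≡x) → x≢e (sym e≡x) ; (inj₂ e≡y) → y≢e (sym e≡y) }

    not-alternate-wrap : ∀ {x} → u ≢ e → u ≢ x → ¬ Alternate (wrap e pre u post) e x
    not-alternate-wrap {x} u≢e u≢x alt =
      repeat-breaks (restrict e x pre) (restrict e x post)
        (subst NoRepeat (filter-wrap-ee (pair? e x) pre post (inj₁ refl) λ { (inj₁ u≡e) → u≢e u≡e ; (inj₂ u≡x) → u≢x u≡x }) alt)

    alternate-wrap : e ∉ pre ++ u ∷ post → e ≢ u → occ u (pre ++ u ∷ post) ≤ 2 → Alternate (wrap e pre u post) e u
    alternate-wrap e∉ e≢u twice =
      subst NoRepeat (sym restricted)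
        (core (occ u pre) (occ u post) (≤-pred (subst (_≤ 2) occ-split twice)))
      where
        open ≡-Reasoning
        occ-split : occ u (pre ++ u ∷ post) ≡ suc (occ u pre + occ u post)
        occ-split = begin
          occ u (pre ++ u ∷ post)        ≡⟨ occ-++ u pre (u ∷ post) ⟩
          occ u pre + occ u (u ∷ post)   ≡⟨ cong (occ u pre +_) (occ-here u post) ⟩
          occ u pre + suc (occ u post)   ≡⟨ +-suc (occ u pre) (occ u post) ⟩
          suc (occ u pre + occ u post)   ∎
        restricted : restrict e u (wrap e pre u post) ≡ replicate (occ u pre) u ++ e ∷ u ∷ e ∷ replicate (occ u post) u
        restricted = begin
          restrict e u (wrap e pre u post)                         ≡⟨ filter-wrap-eue (pair? e u) pre post (inj₁ refl) (inj₂ refl) ⟩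
          restrict e u pre ++ e ∷ u ∷ e ∷ restrict e u post        ≡⟨ cong₂ (λ a b → a ++ e ∷ u ∷ e ∷ b)
                                                                        (restrict-without pre (e∉ ∘ ∈-++⁺ˡ))
                                                                        (restrict-without post (e∉ ∘ ∈-++⁺ʳ pre ∘ there)) ⟩
          replicate (occ u pre) u ++ e ∷ u ∷ e ∷ replicate (occ u post) u ∎
        u≢e : u ≢ e
        u≢e = e≢u ∘ sym
        core : ∀ a b → a + b ≤ 1 → NoRepeat (replicate a u ++ e ∷ u ∷ e ∷ replicate b u)
        core zero          zero          _ = e≢u , u≢e , tt
        core zero          (suc zero)    _ = e≢u , u≢e , e≢u , tt
        core (suc zero)    zero          _ = u≢e , e≢u , u≢e , tt
        core zero          (suc (suc _)) (s≤s ())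
        core (suc zero)    (suc _)       (s≤s ())
        core (suc (suc _)) _             (s≤s ())

  restrict-unique : ∀ {x y} w → occ x w ≤ 1 → occ y w ≤ 1 → Unique (restrict x y w)
  restrict-unique []      _  _  = []
  restrict-unique {x} {y} (z ∷ w) ox oy with pair? x y z
  ... | yes z∈xy rewrite restrict-keep w z∈xy =
          ¬Any⇒All¬ _ (z∉w ∘ proj₁ ∘ ∈-filter⁻ (pair? x y) {xs = w}) ∷ rest
    where
      rest : Unique (restrict x y w)
      rest = restrict-unique w (≤-trans (occ-tail x z w) ox) (≤-trans (occ-tail y z w) oy)
      at-most-once : occ z (z ∷ w) ≤ 1
      at-most-once = [ (λ { refl → ox }) , (λ { refl → oy }) ] z∈xy
      z∉w : z ∉ w
      z∉w z∈w with subst (_≤ 1) (occ-here z w) at-most-once | occ-∈ z∈w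
      ... | s≤s occ≤0 | one≤occ = contradiction (≤-trans one≤occ occ≤0) λ ()
  ... | no z∉xy rewrite restrict-skip w (z∉xy ∘ inj₁) (z∉xy ∘ inj₂) =
          restrict-unique w (≤-trans (occ-tail x z w) ox) (≤-trans (occ-tail y z w) oy)

  once-alternate : ∀ {x y} w → occ x w ≡ 1 → occ y w ≡ 1 → Alternate w x y
  once-alternate {x} {y} w ox oy =
    unique⇒noRepeat (restrict x y w) (restrict-unique w (≤-reflexive ox) (≤-reflexive oy))

  Σocc : List V → List V → ℕ
  Σocc L w = sum (map (λ v → occ v w) L)

  Σocc-[] : ∀ L → Σocc L [] ≡ 0
  Σocc-[] []      = refl
  Σocc-[] (_ ∷ L) = Σocc-[] L

  Σocc-fresh : ∀ {z} L w → z ∉ L → Σocc L (z ∷ w) ≡ Σocc L w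
  Σocc-fresh []      w _   = refl
  Σocc-fresh (v ∷ L) w z∉ = cong₂ _+_ (occ-there w (λ v≡z → z∉ (here (sym v≡z)))) (Σocc-fresh L w (z∉ ∘ there))

  Σocc-∷ : ∀ {L} z w → Unique L → Σocc L (z ∷ w) ≤ suc (Σocc L w)
  Σocc-∷ {[]}    z w _ = z≤n
  Σocc-∷ {v ∷ L} z w (v∉L ∷ unique) = by-cases (v ≟ z)
    where
      by-cases : Dec (v ≡ z) → Σocc (v ∷ L) (z ∷ w) ≤ suc (Σocc (v ∷ L) w)
      by-cases (yes refl) rewrite occ-here v w | Σocc-fresh L w (All¬⇒¬Any v∉L) = ≤-refl
      by-cases (no v≢z) rewrite occ-there w v≢z | sym (+-suc (occ v w) (Σocc L w)) =
        +-monoʳ-≤ (occ v w) (Σocc-∷ z w unique)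

  Σocc≤length : ∀ {L} → Unique L → ∀ w → Σocc L w ≤ length w
  Σocc≤length {L} _      []      = ≤-reflexive (Σocc-[] L)
  Σocc≤length     unique (z ∷ w) = ≤-trans (Σocc-∷ z w unique) (s≤s (Σocc≤length unique w))

  once? : (w : List V) → Decidable (λ v → occ v w ≡ 1)
  once? w v = occ v w ≟ℕ 1

  -- Every letter of w contributes at least two to  occurrences + [occurs exactly once].
  twice-bound : ∀ L w → L ⊆ w →
                length L + length L ≤ Σocc L w + length (filter (once? w) L)
  twice-bound []      w _     = z≤n
  twice-bound (v ∷ L) w cover = by-cases (once? w v)
    where
      open ≤-Reasoning
      m S O : ℕ
      m = length L
      S = Σocc L w
      O = length (filter (once? w) L)
      IH : m + m ≤ S + O
      IH = twice-bound L w (cover ∘ there)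
      by-cases : Dec (occ v w ≡ 1) → suc m + suc m ≤ Σocc (v ∷ L) w + length (filter (once? w) (v ∷ L))
      by-cases (yes once) rewrite filter-accept (once? w) {xs = L} once | once = begin
        suc m + suc m      ≡⟨ cong suc (+-suc m m) ⟩
        2 + (m + m)        ≤⟨ s≤s (s≤s IH) ⟩
        2 + (S + O)        ≡⟨ cong suc (sym (+-suc S O)) ⟩
        suc S + suc O      ∎
      by-cases (no ¬once) rewrite filter-reject (once? w) {xs = L} ¬once = begin
        suc m + suc m      ≡⟨ cong suc (+-suc m m) ⟩
        2 + (m + m)        ≤⟨ +-mono-≤ twice IH ⟩
        occ v w + (S + O)  ≡⟨ sym (+-assoc (occ v w) S O) ⟩
        occ v w + S + O    ∎
        where
          twice : 2 ≤ occ v w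
          twice = ≤∧≢⇒< (occ-∈ (cover (here refl))) (¬once ∘ sym)

module GraphFacts {n : ℕ} (G : Graph n) where

  edge-sym : ∀ {x y} → Edge G x y → Edge G y x
  edge-sym {x} {y} = subst T (Graph.sym G x y)

  edge-irrefl : ∀ {x y} → Edge G x y → x ≢ y
  edge-irrefl {x} xy refl = subst T (Graph.irrefl G x) xy

  TriangleFree : Set
  TriangleFree = ∀ x y z → Edge G x y → Edge G y z → Edge G z x → ⊥

  acyclic⇒triangleFree : Acyclic G → TriangleFree
  acyclic⇒triangleFree acyclic x y z xy yz zx =
    acyclic (x ∷ y ∷ z ∷ [])
      ( s≤s (s≤s (s≤s z≤n))
      , ((edge-irrefl xy ∷ (edge-irrefl zx ∘ sym) ∷ []) ∷ (edge-irrefl yz ∷ []) ∷ [] ∷ [])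
      , step x y _ xy (step y z _ yz (single z))
      , x , z , refl , refl , zx )

  clique-size : TriangleFree → (K : List (Fin n)) → Unique K →
                (∀ {x y} → x ∈ K → y ∈ K → x ≢ y → Edge G x y) → length K ≤ 2
  clique-size _  []          _ _ = z≤n
  clique-size _  (_ ∷ [])     _ _ = s≤s z≤n
  clique-size _  (_ ∷ _ ∷ []) _ _ = s≤s (s≤s z≤n)
  clique-size tf (x ∷ y ∷ z ∷ K) ((x≢y ∷ x≢z ∷ _) ∷ (y≢z ∷ _) ∷ _) adjacent =
    ⊥-elim (tf x y z (adjacent x∈ y∈ x≢y) (adjacent y∈ z∈ y≢z) (adjacent z∈ x∈ (x≢z ∘ sym)))
    where
      x∈ : x ∈ x ∷ y ∷ z ∷ K
      x∈ = here refl
      y∈ : y ∈ x ∷ y ∷ z ∷ K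
      y∈ = there (here refl)
      z∈ : z ∈ x ∷ y ∷ z ∷ K
      z∈ = there (there (here refl))

module LowerBound {n : ℕ} (G : Graph n) (triangle-free : GraphFacts.TriangleFree G) where
  open Words
  open GraphFacts G

  module _ (w : List (Fin n)) (represents : WordRepresents w G) where

    private
      once-letters : List (Fin n)
      once-letters = filter (once? w) (allFin n)

      once-clique : ∀ {x y} → x ∈ once-letters → y ∈ once-letters → x ≢ y → Edge G x y
      once-clique {x} {y} x∈ y∈ x≢y =
        proj₂ (proj₂ represents x y x≢y)
          (once-alternate w (proj₂ (∈-filter⁻ (once? w) {xs = allFin n} x∈)) (proj₂ (∈-filter⁻ (once? w) {xs = allFin n} y∈)))

    lower-bound : 2 * n ∸ 2 ≤ length w
    lower-bound = begin
      2 * n ∸ 2                                                 ≡⟨ cong (λ m → n + m ∸ 2) (+-identityʳ n) ⟩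
      n + n ∸ 2                                                 ≡⟨ cong (λ m → m + m ∸ 2) (sym length-allFin) ⟩
      length (allFin n) + length (allFin n) ∸ 2                 ≤⟨ ∸-monoˡ-≤ 2 (twice-bound (allFin n) w (λ {v} _ → proj₁ represents v)) ⟩
      Σocc (allFin n) w + length once-letters ∸ 2                ≤⟨ ∸-monoˡ-≤ 2 (+-mono-≤ (Σocc≤length (allFin⁺ n) w) few-once) ⟩
      length w + 2 ∸ 2                                          ≡⟨ m+n∸n≡m (length w) 2 ⟩
      length w                                                  ∎
      where
        open ≤-Reasoning
        length-allFin : length (allFin n) ≡ n
        length-allFin = length-tabulate id
        few-once : length once-letters ≤ 2
        few-once = clique-size triangle-free once-letters (filter⁺ (once? w) (allFin⁺ n)) once-clique

module UpperBound {n : ℕ} (G : Graph n) (acyclic : Acyclic G) where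
  open Words
  open GraphFacts G
  open import Data.List.Membership.DecPropositional (_≟_ {n}) using (_∈?_)

  private
    V : Set
    V = Fin n

  other? : (e : V) → Decidable (_≢ e)
  other? e z = ¬? (z ≟ e)

  delete : V → List V → List V
  delete e = filter (other? e)

  delete-∈⁺ : ∀ {e z L} → z ∈ L → z ≢ e → z ∈ delete e L
  delete-∈⁺ {e} = ∈-filter⁺ (other? e)

  delete-∈⁻ : ∀ {e z} L → z ∈ delete e L → z ∈ L × z ≢ e
  delete-∈⁻ {e} L = ∈-filter⁻ (other? e) {xs = L}

  delete-unique : ∀ {e L} → Unique L → Unique (delete e L)
  delete-unique {e} = filter⁺ (other? e)

  delete-length : ∀ {e} L → Unique L → e ∈ L → suc (length (delete e L)) ≡ length L
  delete-length {e} (z ∷ L) (z∉L ∷ _) (here refl) =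
    cong suc (trans (cong length (filter-reject (other? e) {xs = L} (λ e≢e → e≢e refl)))
                    (cong length (filter-all (other? e) (All.map (_∘ sym) z∉L))))
  delete-length {e} (z ∷ L) (z∉L ∷ unique) (there e∈L) =
    trans (cong (suc ∘ length) (filter-accept (other? e) {xs = L} (All.lookup z∉L e∈L)))
          (cong suc (delete-length L unique e∈L))

  pigeonhole : ∀ {L} p → Unique L → Unique p → p ⊆ L → length p ≤ length L
  pigeonhole []      _       _              _   = z≤n
  pigeonhole {L} (a ∷ p) unique (a∉p ∷ unique-p) p⊆L =
    subst (suc (length p) ≤_) (delete-length L unique (p⊆L (here refl)))
      (s≤s (pigeonhole p (delete-unique unique) unique-p
              (λ z∈p → delete-∈⁺ (p⊆L (there z∈p)) (λ z≡a → All.lookup a∉p z∈p (sym z≡a)))))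

  data PathIn (L : List V) : V → V → Set where
    stay : ∀ {x} → x ∈ L → PathIn L x x
    move : ∀ {x y z} → x ∈ L → Edge G x y → PathIn L y z → PathIn L x z

  ConnectedOn : List V → Set
  ConnectedOn L = ∀ {x y} → x ∈ L → y ∈ L → PathIn L x y

  path-start : ∀ {L x y} → PathIn L x y → x ∈ L
  path-start (stay x∈)     = x∈
  path-start (move x∈ _ _) = x∈

  first-step : ∀ {L x y} → PathIn L x y → x ≢ y → Σ V λ z → z ∈ L × Edge G x z
  first-step (stay _)       x≢x = ⊥-elim (x≢x refl)
  first-step (move _ xz p) _    = _ , path-start p , xz

  connected-on-all : Connected G → ConnectedOn (allFin n)
  connected-on-all connected {x} {y} _ _ =
    let _ , walk , first , last = connected x y in from-walk walk first last
    where
      from-walk : ∀ {p x y} → IsWalk G p → head? p x → last? p y → PathIn (allFin n) x y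
      from-walk (single x)            refl refl = stay (∈-allFin x)
      from-walk (step x _ _ xz walk) refl last = move (∈-allFin x) xz (from-walk walk refl last)

  unique-++ˡ : ∀ (xs : List V) {ys} → Unique (xs ++ ys) → Unique xs
  unique-++ˡ []       _          = []
  unique-++ˡ (x ∷ xs) (x∉ ∷ unique) = ++⁻ˡ xs x∉ ∷ unique-++ˡ xs unique

  walk-++ˡ : ∀ x xs {ys} → IsWalk G (x ∷ xs ++ ys) → IsWalk G (x ∷ xs)
  walk-++ˡ x []       _                     = single x
  walk-++ˡ x (y ∷ xs) (step _ _ _ xy walk) = step x y xs xy (walk-++ˡ y xs walk)

  last-snoc : ∀ x xs (z : V) → last? (x ∷ xs ++ z ∷ []) z
  last-snoc x []       z = refl
  last-snoc x (y ∷ xs) z = last-snoc y xs z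

  SimplePathIn : List V → List V → Set
  SimplePathIn L p = Unique p × IsWalk G p × p ⊆ L

  -- A simple path in L, listed from its end backwards, that cannot be prolonged at its end.
  record MaximalPath (L : List V) : Set where
    constructor maximal-path
    field
      end     : V
      rest    : List V
      simple  : SimplePathIn L (end ∷ rest)
      maximal : ∀ {z} → z ∈ L → Edge G end z → z ∈ end ∷ rest

  module _ {L : List V} (unique : Unique L) where

    private
      fresh-neighbour? : (e : V) (p : List V) → Decidable (λ z → Edge G e z × z ∉ p)
      fresh-neighbour? e p z = T? (adj G e z) ×-dec ¬? (z ∈? p)

      extend : ∀ {z e rest} → z ∈ L → Edge G e z → z ∉ e ∷ rest →
               SimplePathIn L (e ∷ rest) → SimplePathIn L (z ∷ e ∷ rest)
      extend {z} {e} {rest} z∈L ez z∉ (unique-p , walk , p⊆L) =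
        ¬Any⇒All¬ _ z∉ ∷ unique-p , step z e rest (edge-sym ez) walk , λ { (here refl) → z∈L ; (there m) → p⊆L m }

    -- Prolong the path at its end while possible; the path never outgrows L (pigeonhole),
    -- so  length L  steps of fuel suffice.
    grow : ∀ fuel e rest → length L ≤ fuel + length (e ∷ rest) → SimplePathIn L (e ∷ rest) → MaximalPath L
    grow fuel e rest bound path with any? (fresh-neighbour? e (e ∷ rest)) L
    ... | no none = maximal-path e rest path
                      (λ z∈L ez → decidable-stable (_ ∈? _) (λ z∉ → none (lose z∈L (ez , z∉))))
    ... | yes found with find found | fuel
    ... | z , z∈L , ez , z∉ | zero =
          let unique-z , _ , p⊆L = extend z∈L ez z∉ path
          in ⊥-elim (<-irrefl refl (≤-trans (pigeonhole (z ∷ e ∷ rest) unique unique-z p⊆L) bound))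
    ... | z , z∈L , ez , z∉ | suc fuel =
          grow fuel z (e ∷ rest) (subst (length L ≤_) (sym (+-suc fuel _)) bound) (extend z∈L ez z∉ path)

    find-maximal-path : ∀ {a} → a ∈ L → MaximalPath L
    find-maximal-path {a} a∈L =
      grow (length L) a [] (m≤m+n (length L) 1) ([] ∷ [] , single a , λ { (here refl) → a∈L })

  record Leaf (L : List V) : Set where
    field
      leaf parent : V
      leaf∈       : leaf ∈ L
      parent∈     : parent ∈ L
      edge        : Edge G leaf parent
      only        : ∀ {z} → z ∈ L → Edge G leaf z → z ≡ parent

  -- The end of a maximal path is a leaf: a second neighbour further along the path would close
  -- a cycle, and a path consisting of its end alone contradicts connectivity.
  maximal⇒leaf : ∀ {L} → ConnectedOn L → (∀ e → Σ V λ y → y ∈ L × e ≢ y) → MaximalPath L → Leaf L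
  maximal⇒leaf connected another (maximal-path e [] (_ , _ , p⊆L) maximal) =
    let y , y∈L , e≢y = another e
        z , z∈L , ez  = first-step (connected (p⊆L (here refl)) y∈L) e≢y
    in ⊥-elim (lone (maximal z∈L ez) ez)
    where
      lone : ∀ {z} → z ∈ e ∷ [] → ¬ Edge G e z
      lone (here refl) ez = edge-irrefl ez refl
  maximal⇒leaf {L} _ _ (maximal-path e (u ∷ rest) (unique , walk , p⊆L) maximal) = record
    { leaf = e ; parent = u ; leaf∈ = p⊆L (here refl) ; parent∈ = p⊆L (there (here refl))
    ; edge = first-edge walk ; only = only }
    where
      first-edge : IsWalk G (e ∷ u ∷ rest) → Edge G e u
      first-edge (step _ _ _ eu _) = eu
      no-chord : ∀ {z} → z ∈ rest → ¬ Edge G e z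
      no-chord {z} z∈rest ez with ∈-∃++ z∈rest
      ... | ys , zs , rest≡ = acyclic cycle
              ( s≤s (s≤s (subst (1 ≤_) (sym (length-++-sucʳ ys z [])) (s≤s z≤n)))
              , unique-++ˡ cycle (subst Unique path≡ unique)
              , walk-++ˡ e (u ∷ ys ++ z ∷ []) (subst (IsWalk G) path≡ walk)
              , e , z , refl , last-snoc e (u ∷ ys) z , edge-sym ez )
        where
          cycle : List V
          cycle = e ∷ u ∷ ys ++ z ∷ []
          path≡ : e ∷ u ∷ rest ≡ cycle ++ zs
          path≡ = cong (λ r → e ∷ u ∷ r) (trans rest≡ (sym (++-assoc ys (z ∷ []) zs)))
      only : ∀ {z} → z ∈ L → Edge G e z → z ≡ u
      only z∈L ez with maximal z∈L ez
      ... | here refl                = ⊥-elim (edge-irrefl ez refl)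
      ... | there (here z≡u)         = z≡u
      ... | there (there z∈rest)     = ⊥-elim (no-chord z∈rest ez)

  leaf-exists : ∀ {L} → Unique L → 2 ≤ length L → ConnectedOn L → Leaf L
  leaf-exists {[]}    _ () _
  leaf-exists {_ ∷ []} _ (s≤s ()) _
  leaf-exists {a ∷ b ∷ _} unique@((a≢b ∷ _) ∷ _) _ connected =
    maximal⇒leaf connected another (find-maximal-path unique (here refl))
    where
      another : ∀ e → Σ V λ y → y ∈ a ∷ b ∷ _ × e ≢ y
      another e with e ≟ a
      ... | yes refl = b , there (here refl) , a≢b
      ... | no e≢a   = a , here refl , e≢a

  Faithful : List V → V → V → Set
  Faithful w x y = (Edge G x y → Alternate w x y) × (Alternate w x y → Edge G x y)

  faithful-sym : ∀ w {x y} → Faithful w x y → Faithful w y x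
  faithful-sym w (edge→alt , alt→edge) =
    (λ yx → alternate-sym w (edge→alt (edge-sym yx))) , (λ alt → edge-sym (alt→edge (alternate-sym w alt)))

  record RepresentsOn (L w : List V) : Set where
    field
      covers        : L ⊆ w
      within        : w ⊆ L
      at-most-twice : ∀ v → occ v w ≤ 2
      faithful      : ∀ {x y} → x ∈ L → y ∈ L → x ≢ y → Faithful w x y

  two-vertex-word : ∀ {a b} → Edge G a b → RepresentsOn (a ∷ b ∷ []) (a ∷ b ∷ [])
  two-vertex-word {a} {b} ab = record
    { covers = id ; within = id ; at-most-twice = λ v → length-filter (v ≟_) (a ∷ b ∷ []) ; faithful = faithful }
    where
      alternate-ab : Alternate (a ∷ b ∷ []) a b
      alternate-ab = subst NoRepeat (sym (filter-all (pair? a b) {xs = a ∷ b ∷ []} (inj₁ refl ∷ inj₂ refl ∷ [])))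
                                    (edge-irrefl ab , tt)
      faithful-ab : Faithful (a ∷ b ∷ []) a b
      faithful-ab = (λ _ → alternate-ab) , (λ _ → ab)
      faithful : ∀ {x y} → x ∈ a ∷ b ∷ [] → y ∈ a ∷ b ∷ [] → x ≢ y → Faithful (a ∷ b ∷ []) x y
      faithful (here refl)         (there (here refl)) _   = faithful-ab
      faithful (there (here refl)) (here refl)         _   = faithful-sym (a ∷ b ∷ []) faithful-ab
      faithful (here refl)         (here refl)         x≢x = ⊥-elim (x≢x refl)
      faithful (there (here refl)) (there (here refl)) x≢x = ⊥-elim (x≢x refl)

  two-vertex-edge : ∀ {a b} → a ≢ b → ConnectedOn (a ∷ b ∷ []) → Edge G a b
  two-vertex-edge a≢b connected with first-step (connected (here refl) (there (here refl))) a≢b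
  ... | _ , here refl         , aa = ⊥-elim (edge-irrefl aa refl)
  ... | _ , there (here refl) , ab = ab

  module _ {L : List V} (ℓ : Leaf L) where
    open Leaf ℓ renaming (leaf to e; parent to u)

    private
      L′ : List V
      L′ = delete e L

      u≢e : u ≢ e
      u≢e = edge-irrefl edge ∘ sym

    -- A path of L between vertices other than the leaf e can avoid e: it can only enter e
    -- from u, and must leave e back to u.
    reroute : ∀ {x y} → PathIn L x y → x ≢ e → y ≢ e → PathIn L′ x y
    reroute-from-leaf : ∀ {y} → PathIn L e y → y ≢ e → PathIn L′ u y

    reroute (stay x∈L) x≢e _ = stay (delete-∈⁺ x∈L x≢e)
    reroute {x} {y} (move {y = z} x∈L xz p) x≢e y≢e with z ≟ e
    ... | yes refl = subst (λ t → PathIn L′ t y) (sym (only x∈L (edge-sym xz))) (reroute-from-leaf p y≢e)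
    ... | no z≢e   = move (delete-∈⁺ x∈L x≢e) xz (reroute p z≢e y≢e)

    reroute-from-leaf (stay _) e≢e = ⊥-elim (e≢e refl)
    reroute-from-leaf {y} (move {y = z} _ ez p) y≢e with only (path-start p) ez
    ... | refl = reroute p u≢e y≢e

    connected-delete : ConnectedOn L → ConnectedOn L′
    connected-delete connected x∈ y∈ =
      let x∈L , x≢e = delete-∈⁻ L x∈
          y∈L , y≢e = delete-∈⁻ L y∈
      in reroute (connected x∈L y∈L) x≢e y≢e

    attach-leaf-at : ∀ pre post → RepresentsOn L′ (pre ++ u ∷ post) → RepresentsOn L (wrap e pre u post)
    attach-leaf-at pre post rep′ = record
      { covers = covers ; within = within ; at-most-twice = at-most-twice ; faithful = faithful }
      where
        module R = RepresentsOn rep′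
        w′ w : List V
        w′ = pre ++ u ∷ post
        w  = wrap e pre u post
        e∉w′ : e ∉ w′
        e∉w′ e∈ = proj₂ (delete-∈⁻ L (R.within e∈)) refl
        covers : L ⊆ w
        covers {v} v∈L with v ≟ e
        ... | yes refl = wrap-∈-new e pre u post
        ... | no v≢e   = wrap-∈-old e pre u post (R.covers (delete-∈⁺ v∈L v≢e))
        within : w ⊆ L
        within v∈ with wrap-∈⁻ e pre u post v∈
        ... | inj₁ refl = leaf∈
        ... | inj₂ v∈w′ = proj₁ (delete-∈⁻ L (R.within v∈w′))
        at-most-twice : ∀ v → occ v w ≤ 2
        at-most-twice v with v ≟ e
        ... | yes refl = ≤-reflexive (occ-wrap-new pre post e∉w′ (u≢e ∘ sym))
        ... | no v≢e   = subst (_≤ 2) (sym (occ-wrap-old pre post v≢e)) (R.at-most-twice v)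
        faithful-leaf : ∀ {y} → y ∈ L → y ≢ e → Faithful w e y
        faithful-leaf {y} y∈L y≢e with y ≟ u
        ... | yes refl = (λ _ → alternate-wrap pre post e∉w′ (u≢e ∘ sym) (R.at-most-twice u)) , (λ _ → edge)
        ... | no y≢u   = (λ ey → ⊥-elim (y≢u (only y∈L ey)))
                       , (λ alt → ⊥-elim (not-alternate-wrap pre post u≢e (y≢u ∘ sym) alt))
        faithful-old : ∀ {x y} → x ∈ L → y ∈ L → x ≢ y → x ≢ e → y ≢ e → Faithful w x y
        faithful-old {x} {y} x∈L y∈L x≢y x≢e y≢e =
          subst (λ r → (Edge G x y → NoRepeat r) × (NoRepeat r → Edge G x y))
                (sym (restrict-wrap-old pre post x≢e y≢e))
                (R.faithful (delete-∈⁺ x∈L x≢e) (delete-∈⁺ y∈L y≢e) x≢y)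
        faithful : ∀ {x y} → x ∈ L → y ∈ L → x ≢ y → Faithful w x y
        faithful {x} {y} x∈L y∈L x≢y with x ≟ e | y ≟ e
        ... | yes refl | yes refl = ⊥-elim (x≢y refl)
        ... | yes refl | no y≢e   = faithful-leaf y∈L y≢e
        ... | no x≢e   | yes refl = faithful-sym w (faithful-leaf x∈L x≢e)
        ... | no x≢e   | no y≢e   = faithful-old x∈L y∈L x≢y x≢e y≢e

    attach-leaf : ∀ {w′} → RepresentsOn L′ w′ → Σ (List V) λ w → RepresentsOn L w × length w ≡ 2 + length w′
    attach-leaf rep′ with ∈-∃++ (RepresentsOn.covers rep′ (delete-∈⁺ parent∈ u≢e))
    ... | pre , post , refl = wrap e pre u post , attach-leaf-at pre post rep′ , length-wrap e pre u post

  build : ∀ k L → length L ≡ 2 + k → Unique L → ConnectedOn L →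
          Σ (List V) λ w → RepresentsOn L w × 2 + length w ≡ 2 * length L
  build zero [] () _ _
  build zero (_ ∷ []) () _ _
  build zero (_ ∷ _ ∷ _ ∷ _) () _ _
  build zero (a ∷ b ∷ []) _ ((a≢b ∷ _) ∷ _) connected =
    a ∷ b ∷ [] , two-vertex-word (two-vertex-edge a≢b connected) , refl
  build (suc k) L length≡ unique connected
    with leaf-exists unique (subst (2 ≤_) (sym length≡) (s≤s (s≤s z≤n))) connected
  ... | ℓ with build k (delete (Leaf.leaf ℓ) L) length′≡ (delete-unique unique) (connected-delete ℓ connected)
    where
      length′≡ : length (delete (Leaf.leaf ℓ) L) ≡ 2 + k
      length′≡ = suc-injective (trans (delete-length L unique (Leaf.leaf∈ ℓ)) length≡)
  ... | w′ , rep′ , length-w′ with attach-leaf ℓ rep′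
  ... | w , rep , length-w = w , rep , (begin
    2 + length w                        ≡⟨ cong (2 +_) length-w ⟩
    2 + (2 + length w′)                 ≡⟨ cong (2 +_) length-w′ ⟩
    2 + 2 * length L′                   ≡⟨ sym (*-suc 2 (length L′)) ⟩
    2 * suc (length L′)                 ≡⟨ cong (2 *_) (delete-length L unique (Leaf.leaf∈ ℓ)) ⟩
    2 * length L                        ∎)
    where
      open ≡-Reasoning
      L′ : List V
      L′ = delete (Leaf.leaf ℓ) L

  tree-word : Connected G → 2 ≤ n → Σ (List V) λ w → WordRepresents w G × length w ≡ 2 * n ∸ 2
  tree-word connected 2≤n
    with build (n ∸ 2) (allFin n) length≡ (allFin⁺ n) (connected-on-all connected)
    where
      length≡ : length (allFin n) ≡ 2 + (n ∸ 2)
      length≡ = trans (length-tabulate id) (sym (m+[n∸m]≡n 2≤n))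
  ... | w , rep , length-w =
    w , ((λ v → covers (∈-allFin v)) , (λ x y → faithful (∈-allFin x) (∈-allFin y))) ,
    cong (_∸ 2) (trans length-w (cong (2 *_) (length-tabulate {n = n} id)))
    where open RepresentsOn rep

theorem3 : ∀ (n : ℕ) → 2 ≤ n → (T : Graph n) → IsTree T → MinRepLength T (2 * n ∸ 2)
theorem3 n 2≤n T (connected , acyclic) =
    UpperBound.tree-word T acyclic connected 2≤n
  , LowerBound.lower-bound T (GraphFacts.acyclic⇒triangleFree T acyclic)
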